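{- For $\textsc{Cis}_2$ played on paths, let $GF(e,x,y,t)=\sum_{n\ge0}\sum_{\text{positions on }P_n} e^{\#\text{empty}}x^{\#\text{blue}}y^{\#\text{red}}\,t^n$. Then \[GF(e,x,y,t)=\frac{1+xt+yt+(xt+yt)^2+et\bigl(xt+yt+(xt+yt)^2\bigr)}{1-et-e^2t^2\bigl(xt+yt+(xt+yt)^2\bigr)}.\] In particular the generating function of the polynomial profiles $\sum_{n\ge0}P_{\textsc{Cis}_2,P_n}(x,y)t^n$ is $GF(1,x,y,t)$, and the generating function of the total number of positions is \[\sum_{n\ge0}P_{\textsc{Cis}_2,P_n}(1,1)t^n=\frac{1+2t+6t^2+4t^3}{1-t-2t^3-4t^4}.\]
   Context: A distance game given by a pair of sets $(S,D)$ of positive integers is played on a finite graph by two players, Left (colouring vertices blue) and Right (colouring vertices red). A position is any assignment to a subset of the vertices of the colours blue or red (other vertices empty) such that no two vertices of the same colour are at graph distance in $S$ and no two vertices of different colours are at graph distance in $D$; no assumption of alternating play is made. $\textsc{Cis}_2$ is the distance game with $S=D=\{2\}$. The polynomial profile is $P_{G,B}(x,y)=\sum f_{j,l}x^jy^l$ with $f_{j,l}$ the number of positions with $j$ blue and $l$ red vertices. $P_n$ is the path with $n$ vertices ($P_0$ empty, with the single empty position). -}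

module Defs where

open import Level using (Level)
open import Data.Nat using (ℕ; zero; suc; _∸_; ∣_-_∣; _≟_)
open import Data.Fin using (Fin; toℕ)
open import Data.Fin.Properties using (all?)
open import Data.Vec using (Vec; []; _∷_; lookup)
import Data.List
open import Data.List using (List; []; _∷_; [_]; map; concatMap; filter; length; upTo)
open import Data.Empty using (⊥)
open import Data.Unit using (⊤)
open import Relation.Nullary using (Dec; yes; no; ¬_; ¬?)

open import Relation.Unary using (Pred; Decidable)
open import Relation.Binary.PropositionalEquality using (_≡_)
open import Algebra.Bundles using (CommutativeRing)

-- Colours of vertices: empty, blue (Left), red (Right)

data Colour : Set where
  empty blue red : Colour

-- The path P_n: vertices Fin n, vertex i adjacent to i+1;
-- the graph distance between i and j is |i - j|.
pathDist : {n : ℕ} → Fin n → Fin n → ℕ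
pathDist i j = ∣ toℕ i - toℕ j ∣

Colouring : ℕ → Set
Colouring n = Vec Colour n

Conflict : (S D : Pred ℕ Level.zero) → Colour → Colour → ℕ → Set
Conflict S D blue blue d = S d
Conflict S D red  red  d = S d
Conflict S D blue red  d = D d
Conflict S D red  blue d = D d
Conflict S D empty _   d = ⊥
Conflict S D blue empty d = ⊥
Conflict S D red  empty d = ⊥

IsPosition : (S D : Pred ℕ Level.zero) {n : ℕ} → Colouring n → Set
IsPosition S D {n} c =
  (i j : Fin n) → ¬ Conflict S D (lookup c i) (lookup c j) (pathDist i j)

conflict? : {S D : Pred ℕ Level.zero} → Decidable S → Decidable D →
            (a b : Colour) (d : ℕ) → Dec (Conflict S D a b d)
conflict? S? D? blue blue d = S? d
conflict? S? D? red  red  d = S? d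
conflict? S? D? blue red  d = D? d
conflict? S? D? red  blue d = D? d
conflict? S? D? empty _   d = no (λ ())
conflict? S? D? blue empty d = no (λ ())
conflict? S? D? red  empty d = no (λ ())

isPosition? : {S D : Pred ℕ Level.zero} → Decidable S → Decidable D →
              {n : ℕ} → (c : Colouring n) → Dec (IsPosition S D c)
isPosition? S? D? c =
  all? (λ i → all? (λ j → ¬? (conflict? S? D? (lookup c i) (lookup c j) (pathDist i j))))

S₂ : Pred ℕ Level.zero
S₂ d = d ≡ 2

S₂? : Decidable S₂
S₂? d = d ≟ 2

IsCis2Position : {n : ℕ} → Colouring n → Set
IsCis2Position = IsPosition S₂ S₂

isCis2Position? : {n : ℕ} → (c : Colouring n) → Dec (IsCis2Position c)
isCis2Position? = isPosition? S₂? S₂?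

allColourings : (n : ℕ) → List (Colouring n)
allColourings zero = [ [] ]
allColourings (suc n) =
  concatMap (λ v → Data.List._∷_ (empty ∷ v) (Data.List._∷_ (blue ∷ v) [ red ∷ v ])) (allColourings n)

cis2Positions : (n : ℕ) → List (Colouring n)
cis2Positions n = filter isCis2Position? (allColourings n)

countColour : Colour → {n : ℕ} → Colouring n → ℕ
countColour k [] = 0
countColour empty (empty ∷ v) = suc (countColour empty v)
countColour blue  (blue  ∷ v) = suc (countColour blue v)
countColour red   (red   ∷ v) = suc (countColour red v)
countColour k     (_     ∷ v) = countColour k v

-- total number of positions of Cis_2 on P_n, i.e. P_{Cis_2,P_n}(1,1)
numPositions : ℕ → ℕ
numPositions n = length (cis2Positions n)

-- Formal power series in t over a commutative ring, as coefficient
-- sequences ℕ → R; the product is the Cauchy product.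

module Series {c ℓ : Level} (R : CommutativeRing c ℓ) where
  open CommutativeRing R

  pow : Carrier → ℕ → Carrier
  pow a zero = 1#
  pow a (suc k) = a * pow a k

  sumR : List Carrier → Carrier
  sumR [] = 0#
  sumR (a ∷ as) = a + sumR as

  cauchy : (ℕ → Carrier) → (ℕ → Carrier) → ℕ → Carrier
  cauchy a b n = sumR (map (λ k → a k * b (n ∸ k)) (upTo (suc n)))

  weight : Carrier → Carrier → Carrier → {n : ℕ} → Colouring n → Carrier
  weight e x y c = pow e (countColour empty c) * (pow x (countColour blue c) * pow y (countColour red c))

  gfCoeff : Carrier → Carrier → Carrier → ℕ → Carrier
  gfCoeff e x y n = sumR (map (weight e x y) (cis2Positions n))

  profile : Carrier → Carrier → ℕ → Carrier
  profile x y n = sumR (map (λ c → pow x (countColour blue c) * pow y (countColour red c)) (cis2Positions n))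

  -- Numerator  1 + xt + yt + (xt+yt)^2 + et(xt + yt + (xt+yt)^2),
  -- coefficients in t, with s = x + y:
  --   1 + s t + (s^2 + e s) t^2 + e s^2 t^3
  numCoeff : Carrier → Carrier → Carrier → ℕ → Carrier
  numCoeff e x y 0 = 1#
  numCoeff e x y 1 = x + y
  numCoeff e x y 2 = (x + y) * (x + y) + e * (x + y)
  numCoeff e x y 3 = e * ((x + y) * (x + y))
  numCoeff e x y (suc (suc (suc (suc _)))) = 0#

  -- Denominator  1 - et - e^2 t^2 (xt + yt + (xt+yt)^2),
  -- coefficients in t:  1 - e t - e^2 s t^3 - e^2 s^2 t^4
  denCoeff : Carrier → Carrier → Carrier → ℕ → Carrier
  denCoeff e x y 0 = 1#
  denCoeff e x y 1 = - e
  denCoeff e x y 2 = 0#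
  denCoeff e x y 3 = - ((e * e) * (x + y))
  denCoeff e x y 4 = - ((e * e) * ((x + y) * (x + y)))
  denCoeff e x y (suc (suc (suc (suc (suc _))))) = 0#

-- Integer coefficients of the total-count generating function
-- (1 + 2t + 6t^2 + 4t^3) / (1 - t - 2t^3 - 4t^4)

open import Data.Integer using (ℤ; +_; -[1+_])

numTotal : ℕ → ℤ
numTotal 0 = + 1
numTotal 1 = + 2
numTotal 2 = + 6
numTotal 3 = + 4
numTotal (suc (suc (suc (suc _)))) = + 0

denTotal : ℕ → ℤ
denTotal 0 = + 1
denTotal 1 = -[1+ 0 ]
denTotal 2 = + 0
denTotal 3 = -[1+ 1 ]
denTotal 4 = -[1+ 3 ]
denTotal (suc (suc (suc (suc (suc _))))) = + 0

{-# OPTIONS --safe #-}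
module Submission where

-- In Cis₂ on a path only distance 2 matters, and there any two coloured
-- vertices conflict, whatever their colours. So a colouring is a position
-- iff no vertex i has both i and i+2 coloured, which a left-to-right scan
-- checks by remembering whether the last two vertices were coloured.
-- Summing weights over the four scan states gives linear recurrences; they
-- collapse to GF(n+4) = e GF(n+3) + e²s GF(n+1) + e²s² GF(n) with s = x+y,
-- i.e. GF = Num + (et + e²st³ + e²s²t⁴) GF, the boundary terms of which
-- make up the numerator.

open import Defs
open import Level using (Level)
open import Algebra.Bundles using (CommutativeRing)
open import Data.Bool using (Bool; true; false; T; not; _∧_; if_then_else_)
open import Data.Bool.Properties using (T-∧; ∧-comm)
open import Data.Fin using (Fin; zero; suc; toℕ)
open import Data.Integer using (+_)
open import Data.Integer.Properties using (+-*-commutativeRing)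
open import Data.List using (List; []; _∷_; map; _++_; concatMap; filter; length; upTo)
open import Data.List.Properties using (map-++; map-applyUpTo)
open import Data.Nat using (ℕ; zero; suc; _∸_)
import Data.Nat as ℕ
open import Data.Nat.Properties using (suc-injective)
import Data.Nat.Properties as ℕ
open import Data.Product using (_×_; _,_; proj₁; proj₂)
open import Data.Vec using ([]; _∷_; lookup)
open import Function using (_∘_)
open import Function.Bundles using (mk⇔; Equivalence)
import Relation.Binary.PropositionalEquality as ≡
open ≡ using (_≡_)
open import Relation.Nullary using (¬_; Dec; does)
open import Relation.Nullary.Decidable using (does-⇔; T?)

coloured : Colour → Bool
coloured empty = false
coloured blue  = true
coloured red   = true

firstColoured : {n : ℕ} → Colouring n → Bool
firstColoured []      = false
firstColoured (k ∷ _) = coloured k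

secondColoured : {n : ℕ} → Colouring n → Bool
secondColoured []      = false
secondColoured (_ ∷ v) = firstColoured v

cis2Valid : {n : ℕ} → Colouring n → Bool
cis2Valid []      = true
cis2Valid (k ∷ v) = not (coloured k ∧ secondColoured v) ∧ cis2Valid v

T-not⇒¬T : ∀ {b} → T (not b) → ¬ T b
T-not⇒¬T {false} _ ()

¬T⇒T-not : ∀ {b} → ¬ T b → T (not b)
¬T⇒T-not {false} _ = _
¬T⇒T-not {true} ¬t with () ← ¬t _

cis2Conflict⇒ : ∀ a b d → Conflict S₂ S₂ a b d → d ≡ 2 × T (coloured a ∧ coloured b)
cis2Conflict⇒ blue blue d d≡2 = d≡2 , _
cis2Conflict⇒ blue red  d d≡2 = d≡2 , _
cis2Conflict⇒ red  blue d d≡2 = d≡2 , _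
cis2Conflict⇒ red  red  d d≡2 = d≡2 , _

coloured⇒cis2Conflict : ∀ a b → T (coloured a ∧ coloured b) → Conflict S₂ S₂ a b 2
coloured⇒cis2Conflict blue blue _ = ≡.refl
coloured⇒cis2Conflict blue red  _ = ≡.refl
coloured⇒cis2Conflict red  blue _ = ≡.refl
coloured⇒cis2Conflict red  red  _ = ≡.refl

secondColoured-lookup : ∀ {n} (v : Colouring n) (j : Fin n) → toℕ j ≡ 1 →
                        secondColoured v ≡ coloured (lookup v j)
secondColoured-lookup (_ ∷ _ ∷ _) (suc zero) _ = ≡.refl

position⇒cis2Valid : ∀ {n} (c : Colouring n) → IsCis2Position c → T (cis2Valid c)
position⇒cis2Valid []      _ = _
position⇒cis2Valid (k ∷ v) P =
  Equivalence.from T-∧ (¬T⇒T-not (head-clear v P) , position⇒cis2Valid v (λ i j → P (suc i) (suc j)))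
  where
  head-clear : ∀ {n} (w : Colouring n) → IsCis2Position (k ∷ w) → ¬ T (coloured k ∧ secondColoured w)
  head-clear []          _ h = proj₂ (Equivalence.to T-∧ h)
  head-clear (_ ∷ [])    _ h = proj₂ (Equivalence.to T-∧ h)
  head-clear (_ ∷ l ∷ _) P h = P zero (suc (suc zero)) (coloured⇒cis2Conflict k l h)

cis2Valid⇒position : ∀ {n} (c : Colouring n) → T (cis2Valid c) → IsCis2Position c
cis2Valid⇒position (k ∷ v) valid = apart
  where
  head-apart : ∀ j → suc (toℕ j) ≡ 2 → ¬ T (coloured k ∧ coloured (lookup v j))
  head-apart j d≡2 =
    T-not⇒¬T (proj₁ (Equivalence.to T-∧ valid))
    ∘ ≡.subst (λ b → T (coloured k ∧ b)) (≡.sym (secondColoured-lookup v j (suc-injective d≡2)))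

  apart : IsCis2Position (k ∷ v)
  apart zero zero c with () ← proj₁ (cis2Conflict⇒ k k 0 c)
  apart zero (suc j) c with d≡2 , h ← cis2Conflict⇒ k (lookup v j) _ c = head-apart j d≡2 h
  apart (suc i) zero c with d≡2 , h ← cis2Conflict⇒ (lookup v i) k _ c =
    head-apart i d≡2 (≡.subst T (∧-comm (coloured (lookup v i)) (coloured k)) h)
  apart (suc i) (suc j) = cis2Valid⇒position v (proj₂ (Equivalence.to T-∧ valid)) i j

isCis2Position?-does : ∀ {n} (c : Colouring n) → does (isCis2Position? c) ≡ cis2Valid c
isCis2Position?-does c =
  does-⇔ (mk⇔ (position⇒cis2Valid c) (cis2Valid⇒position c)) (isCis2Position? c) (T? (cis2Valid c))

mark : Bool → Colour
mark false = empty
mark true  = blue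

extensions : ∀ {n} → Colouring n → List (Colouring (suc n))
extensions v = (empty ∷ v) ∷ (blue ∷ v) ∷ (red ∷ v) ∷ []

module SeriesLemmas {c ℓ : Level} (R : CommutativeRing c ℓ) where
  open CommutativeRing R
  open Series R
  open import Relation.Binary.Reasoning.Setoid setoid
  open import Algebra.Solver.Ring.NaturalCoefficients.Default commutativeSemiring
    using (solve; _:=_; _:+_; _:*_)

  select : Bool → Carrier → Carrier
  select b r = if b then r else 0#

  select-*ˡ : ∀ b k {r r′} → r ≈ k * r′ → select b r ≈ k * select b r′
  select-*ˡ true  k r≈ = r≈
  select-*ˡ false k _  = sym (zeroʳ k)

  sumR-map-cong : ∀ {A : Set} {f g : A → Carrier} (xs : List A) →
                  (∀ a → f a ≈ g a) → sumR (map f xs) ≈ sumR (map g xs)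
  sumR-map-cong []       _   = refl
  sumR-map-cong (a ∷ xs) f≈g = +-cong (f≈g a) (sumR-map-cong xs f≈g)

  sumR-++ : (xs ys : List Carrier) → sumR (xs ++ ys) ≈ sumR xs + sumR ys
  sumR-++ []       ys = sym (+-identityˡ _)
  sumR-++ (a ∷ xs) ys = trans (+-cong refl (sumR-++ xs ys)) (sym (+-assoc _ _ _))

  sumR-concatMap : ∀ {A B : Set} (f : B → Carrier) (g : A → List B) (xs : List A) →
                   sumR (map f (concatMap g xs)) ≈ sumR (map (λ a → sumR (map f (g a))) xs)
  sumR-concatMap f g []       = refl
  sumR-concatMap f g (a ∷ xs) = begin
    sumR (map f (g a ++ concatMap g xs))
      ≡⟨ ≡.cong sumR (map-++ f (g a) (concatMap g xs)) ⟩
    sumR (map f (g a) ++ map f (concatMap g xs))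
      ≈⟨ sumR-++ (map f (g a)) _ ⟩
    sumR (map f (g a)) + sumR (map f (concatMap g xs))
      ≈⟨ +-cong refl (sumR-concatMap f g xs) ⟩
    sumR (map (λ a → sumR (map f (g a))) (a ∷ xs)) ∎

  sumR-+ : ∀ {A : Set} (f g : A → Carrier) (xs : List A) →
           sumR (map (λ a → f a + g a) xs) ≈ sumR (map f xs) + sumR (map g xs)
  sumR-+ f g []       = sym (+-identityˡ _)
  sumR-+ f g (a ∷ xs) =
    trans (+-cong refl (sumR-+ f g xs)) (interchange (f a) (g a) _ _)
    where
    interchange : ∀ p q r t → (p + q) + (r + t) ≈ (p + r) + (q + t)
    interchange = solve 4 (λ p q r t → (p :+ q) :+ (r :+ t) := (p :+ r) :+ (q :+ t)) refl

  sumR-*ˡ : ∀ {A : Set} (k : Carrier) (f : A → Carrier) (xs : List A) →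
            sumR (map (λ a → k * f a) xs) ≈ k * sumR (map f xs)
  sumR-*ˡ k f []       = sym (zeroʳ k)
  sumR-*ˡ k f (a ∷ xs) = trans (+-cong refl (sumR-*ˡ k f xs)) (sym (distribˡ k _ _))

  sumR-filter : ∀ {A : Set} {P : A → Set} (P? : ∀ a → Dec (P a))
                (f : A → Carrier) (xs : List A) →
                sumR (map f (filter P? xs)) ≈ sumR (map (λ a → select (does (P? a)) (f a)) xs)
  sumR-filter P? f [] = refl
  sumR-filter P? f (a ∷ xs) with does (P? a)
  ... | true  = +-cong refl (sumR-filter P? f xs)
  ... | false = trans (sumR-filter P? f xs) (sym (+-identityˡ _))

  cauchy-suc : ∀ (a b : ℕ → Carrier) n →
               cauchy a b (suc n) ≡ a 0 * b (suc n) + cauchy (a ∘ suc) b n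
  cauchy-suc a b n = ≡.cong (λ l → a 0 * b (suc n) + sumR l)
    (≡.trans (map-applyUpTo suc (λ k → a k * b (suc n ∸ k)) (suc n))
             (≡.sym (map-applyUpTo (λ k → k) (λ k → a (suc k) * b (n ∸ k)) (suc n))))

  cauchy-cong : ∀ {a a′ b b′ : ℕ → Carrier} → (∀ k → a k ≈ a′ k) → (∀ k → b k ≈ b′ k) →
                ∀ n → cauchy a b n ≈ cauchy a′ b′ n
  cauchy-cong a≈ b≈ n = sumR-map-cong (upTo (suc n)) (λ k → *-cong (a≈ k) (b≈ (n ∸ k)))

  cauchy-+ʳ : ∀ (a b b′ : ℕ → Carrier) n →
              cauchy a b n + cauchy a b′ n ≈ cauchy a (λ k → b k + b′ k) n
  cauchy-+ʳ a b b′ n = trans (sym (sumR-+ _ _ (upTo (suc n))))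
    (sumR-map-cong (upTo (suc n)) (λ k → sym (distribˡ (a k) _ _)))

  δ : ℕ → Carrier
  δ zero    = 1#
  δ (suc _) = 0#

  cauchy-δʳ : ∀ (a : ℕ → Carrier) n → cauchy a δ n ≈ a n
  cauchy-δʳ a zero    = trans (+-identityʳ _) (*-identityʳ _)
  cauchy-δʳ a (suc n) rewrite cauchy-suc a δ n =
    trans (+-cong (zeroʳ _) (cauchy-δʳ (a ∘ suc) n)) (+-identityˡ _)

  cauchy-shift : ∀ d (b : ℕ → Carrier) → (∀ j → b (suc d ℕ.+ j) ≈ 0#) →
                 ∀ m (a : ℕ → Carrier) → cauchy a b (d ℕ.+ m) ≈ cauchy (λ k → a (k ℕ.+ m)) b d
  cauchy-shift d b b≈0 zero a rewrite ℕ.+-identityʳ d =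
    cauchy-cong {b = b} (λ k → reflexive (≡.cong a (≡.sym (ℕ.+-identityʳ k)))) (λ _ → refl) d
  cauchy-shift d b b≈0 (suc m) a rewrite ℕ.+-suc d m | cauchy-suc a b (d ℕ.+ m) = begin
    a 0 * b (suc (d ℕ.+ m)) + cauchy (a ∘ suc) b (d ℕ.+ m)
      ≈⟨ +-cong (trans (*-cong refl (b≈0 m)) (zeroʳ _)) (cauchy-shift d b b≈0 m (a ∘ suc)) ⟩
    0# + cauchy (λ k → a (suc (k ℕ.+ m))) b d
      ≈⟨ +-identityˡ _ ⟩
    cauchy (λ k → a (suc (k ℕ.+ m))) b d
      ≈⟨ cauchy-cong {b = b} (λ k → reflexive (≡.cong a (≡.sym (ℕ.+-suc k m)))) (λ _ → refl) d ⟩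
    cauchy (λ k → a (k ℕ.+ suc m)) b d ∎

  pow-1# : ∀ k → pow 1# k ≈ 1#
  pow-1# zero    = refl
  pow-1# (suc k) = trans (*-cong refl (pow-1# k)) (*-identityˡ 1#)

  profile≈gfCoeff-1# : ∀ x y n → profile x y n ≈ gfCoeff 1# x y n
  profile≈gfCoeff-1# x y n = sumR-map-cong (cis2Positions n)
    (λ c → sym (trans (*-cong (pow-1# (countColour empty c)) refl) (*-identityˡ _)))

module Cis2GF {c ℓ : Level} (R : CommutativeRing c ℓ) (e x y : CommutativeRing.Carrier R) where
  open CommutativeRing R
  open Series R
  open SeriesLemmas R
  open import Relation.Binary.Reasoning.Setoid setoid
  open import Algebra.Solver.Ring.NaturalCoefficients.Default commutativeSemiring
    using (solve; _:=_; _:+_; _:*_; con)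
  open import Algebra.Properties.Group +-group using (∙-cancelʳ)

  s : Carrier
  s = x + y

  -- The weight of v if v stays a position after two vertices, coloured iff
  -- p resp. q, are put in front of it; gfCoeff is the case p = q = false.
  validWeight : Bool → Bool → ∀ {n} → Colouring n → Carrier
  validWeight p q v = select (cis2Valid (mark p ∷ mark q ∷ v)) (weight e x y v)

  gfAfter : Bool → Bool → ℕ → Carrier
  gfAfter p q n = sumR (map (validWeight p q) (allColourings n))

  A : ℕ → Carrier
  A = gfAfter false false

  weight-empty∷ : ∀ {n} (v : Colouring n) → weight e x y (empty ∷ v) ≈ e * weight e x y v
  weight-empty∷ v = *-assoc _ _ _

  weight-blue∷ : ∀ {n} (v : Colouring n) → weight e x y (blue ∷ v) ≈ x * weight e x y v
  weight-blue∷ v = lemma _ x _ _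
    where
    lemma : ∀ E k X Y → E * ((k * X) * Y) ≈ k * (E * (X * Y))
    lemma = solve 4 (λ E k X Y → E :* ((k :* X) :* Y) := k :* (E :* (X :* Y))) refl

  weight-red∷ : ∀ {n} (v : Colouring n) → weight e x y (red ∷ v) ≈ y * weight e x y v
  weight-red∷ v = lemma _ y _ _
    where
    lemma : ∀ E k X Y → E * (X * (k * Y)) ≈ k * (E * (X * Y))
    lemma = solve 4 (λ E k X Y → E :* (X :* (k :* Y)) := k :* (E :* (X :* Y))) refl

  extensions-free : ∀ q {n} (v : Colouring n) →
    sumR (map (validWeight false q) (extensions v)) ≈ e * validWeight q false v + s * validWeight q true v
  extensions-free q v =
    trans (+-cong (select-*ˡ _ e (weight-empty∷ v))
            (+-cong (select-*ˡ _ x (weight-blue∷ v)) (+-cong (select-*ˡ _ y (weight-red∷ v)) refl)))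
          (collect _ x y _)
    where
    collect : ∀ E X Y Q → E + (X * Q + (Y * Q + 0#)) ≈ E + (X + Y) * Q
    collect = solve 4 (λ E X Y Q → E :+ (X :* Q :+ (Y :* Q :+ con 0)) := E :+ (X :+ Y) :* Q) refl

  extensions-blocked : ∀ q {n} (v : Colouring n) →
    sumR (map (validWeight true q) (extensions v)) ≈ e * validWeight q false v
  extensions-blocked q v = trans (+-cong (select-*ˡ _ e (weight-empty∷ v)) refl) (collect _)
    where
    collect : ∀ E → E + (0# + (0# + 0#)) ≈ E
    collect = solve 1 (λ E → E :+ (con 0 :+ (con 0 :+ con 0)) := E) refl

  weight-[] : weight e x y [] + 0# ≈ 1#
  weight-[] = trans (+-identityʳ _) (trans (*-identityˡ _) (*-identityˡ _))

  gfAfter-zero : ∀ p q → gfAfter p q 0 ≈ 1#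
  gfAfter-zero false false = weight-[]
  gfAfter-zero false true  = weight-[]
  gfAfter-zero true  false = weight-[]
  gfAfter-zero true  true  = weight-[]

  gfAfter-free : ∀ q n → gfAfter false q (suc n) ≈ e * gfAfter q false n + s * gfAfter q true n
  gfAfter-free q n = begin
    gfAfter false q (suc n)
      ≈⟨ sumR-concatMap (validWeight false q) extensions (allColourings n) ⟩
    sumR (map (λ v → sumR (map (validWeight false q) (extensions v))) (allColourings n))
      ≈⟨ sumR-map-cong (allColourings n) (extensions-free q) ⟩
    sumR (map (λ v → e * validWeight q false v + s * validWeight q true v) (allColourings n))
      ≈⟨ sumR-+ _ _ (allColourings n) ⟩
    sumR (map (λ v → e * validWeight q false v) (allColourings n))
      + sumR (map (λ v → s * validWeight q true v) (allColourings n))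
      ≈⟨ +-cong (sumR-*ˡ e _ (allColourings n)) (sumR-*ˡ s _ (allColourings n)) ⟩
    e * gfAfter q false n + s * gfAfter q true n ∎

  gfAfter-blocked : ∀ q n → gfAfter true q (suc n) ≈ e * gfAfter q false n
  gfAfter-blocked q n = begin
    gfAfter true q (suc n)
      ≈⟨ sumR-concatMap (validWeight true q) extensions (allColourings n) ⟩
    sumR (map (λ v → sumR (map (validWeight true q) (extensions v))) (allColourings n))
      ≈⟨ sumR-map-cong (allColourings n) (extensions-blocked q) ⟩
    sumR (map (λ v → e * validWeight q false v) (allColourings n))
      ≈⟨ sumR-*ˡ e _ (allColourings n) ⟩
    e * gfAfter q false n ∎

  gfCoeff≈A : ∀ n → gfCoeff e x y n ≈ A n
  gfCoeff≈A n = trans (sumR-filter isCis2Position? (weight e x y) (allColourings n))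
    (sumR-map-cong (allColourings n)
      (λ v → reflexive (≡.cong (λ b → select b (weight e x y v)) (isCis2Position?-does v))))

  A-recurrence : ∀ m → A (4 ℕ.+ m) ≈ e * A (3 ℕ.+ m) + (e * e * s) * A (1 ℕ.+ m) + (e * e * (s * s)) * A m
  A-recurrence m = begin
    A (4 ℕ.+ m)
      ≈⟨ gfAfter-free false (3 ℕ.+ m) ⟩
    e * A (3 ℕ.+ m) + s * gfAfter false true (3 ℕ.+ m)
      ≈⟨ +-cong refl (*-cong refl (gfAfter-free true (2 ℕ.+ m))) ⟩
    e * A (3 ℕ.+ m) + s * (e * gfAfter true false (2 ℕ.+ m) + s * gfAfter true true (2 ℕ.+ m))
      ≈⟨ +-cong refl (*-cong refl (+-cong (*-cong refl (gfAfter-blocked false (1 ℕ.+ m)))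
           (*-cong refl (trans (gfAfter-blocked true (1 ℕ.+ m)) (*-cong refl (gfAfter-blocked false m)))))) ⟩
    e * A (3 ℕ.+ m) + s * (e * (e * A (1 ℕ.+ m)) + s * (e * (e * A m)))
      ≈⟨ expand e s (A (3 ℕ.+ m)) (A (1 ℕ.+ m)) (A m) ⟩
    e * A (3 ℕ.+ m) + (e * e * s) * A (1 ℕ.+ m) + (e * e * (s * s)) * A m ∎
    where
    expand : ∀ E S A₃ A₁ A₀ → E * A₃ + S * (E * (E * A₁) + S * (E * (E * A₀)))
                            ≈ E * A₃ + (E * E * S) * A₁ + (E * E * (S * S)) * A₀
    expand = solve 5 (λ E S A₃ A₁ A₀ →
      E :* A₃ :+ S :* (E :* (E :* A₁) :+ S :* (E :* (E :* A₀)))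
      := E :* A₃ :+ (E :* E :* S) :* A₁ :+ (E :* E :* (S :* S)) :* A₀) refl

  -- The coefficients of 1 − Den: Den = δ − feedback turns GF·Den = Num into
  -- GF = Num + feedback·GF, which is the recurrence together with its
  -- boundary terms.
  feedback : ℕ → Carrier
  feedback 1 = e
  feedback 3 = (e * e) * s
  feedback 4 = (e * e) * (s * s)
  feedback _ = 0#

  denCoeff+feedback≈δ : ∀ k → denCoeff e x y k + feedback k ≈ δ k
  denCoeff+feedback≈δ 0 = +-identityʳ _
  denCoeff+feedback≈δ 1 = -‿inverseˡ _
  denCoeff+feedback≈δ 2 = +-identityʳ _
  denCoeff+feedback≈δ 3 = -‿inverseˡ _
  denCoeff+feedback≈δ 4 = -‿inverseˡ _
  denCoeff+feedback≈δ (suc (suc (suc (suc (suc _))))) = +-identityʳ _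

  A≈numCoeff+feedback·A : ∀ n → numCoeff e x y n + cauchy A feedback n ≈ A n
  A≈numCoeff+feedback·A 0 = trans (collect (A 0)) (sym (gfAfter-zero false false))
    where
    collect : ∀ A₀ → 1# + (A₀ * 0# + 0#) ≈ 1#
    collect = solve 1 (λ A₀ → con 1 :+ (A₀ :* con 0 :+ con 0) := con 1) refl
  A≈numCoeff+feedback·A 1 = begin
    s + (A 0 * e + (A 1 * 0# + 0#))    ≈⟨ collect e s (A 0) (A 1) ⟩
    e * A 0 + s * 1#                   ≈⟨ +-cong refl (*-cong refl (sym (gfAfter-zero false true))) ⟩
    e * A 0 + s * gfAfter false true 0 ≈⟨ sym (gfAfter-free false 0) ⟩
    A 1 ∎
    where
    collect : ∀ E S A₀ A₁ → S + (A₀ * E + (A₁ * 0# + 0#)) ≈ E * A₀ + S * 1#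
    collect = solve 4 (λ E S A₀ A₁ → S :+ (A₀ :* E :+ (A₁ :* con 0 :+ con 0)) := E :* A₀ :+ S :* con 1) refl
  A≈numCoeff+feedback·A 2 = begin
    (s * s + e * s) + (A 0 * 0# + (A 1 * e + (A 2 * 0# + 0#)))
      ≈⟨ collect e s (A 0) (A 1) (A 2) ⟩
    e * A 1 + s * (e * 1# + s * 1#)
      ≈⟨ +-cong refl (*-cong refl (sym (+-cong (*-cong refl (gfAfter-zero true false))
                                            (*-cong refl (gfAfter-zero true true))))) ⟩
    e * A 1 + s * (e * gfAfter true false 0 + s * gfAfter true true 0)
      ≈⟨ sym (trans (gfAfter-free false 1) (+-cong refl (*-cong refl (gfAfter-free true 0)))) ⟩
    A 2 ∎
    where
    collect : ∀ E S A₀ A₁ A₂ → (S * S + E * S) + (A₀ * 0# + (A₁ * E + (A₂ * 0# + 0#)))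
                             ≈ E * A₁ + S * (E * 1# + S * 1#)
    collect = solve 5 (λ E S A₀ A₁ A₂ →
      (S :* S :+ E :* S) :+ (A₀ :* con 0 :+ (A₁ :* E :+ (A₂ :* con 0 :+ con 0)))
      := E :* A₁ :+ S :* (E :* con 1 :+ S :* con 1)) refl
  A≈numCoeff+feedback·A 3 = begin
    e * (s * s) + (A 0 * ((e * e) * s) + (A 1 * 0# + (A 2 * e + (A 3 * 0# + 0#))))
      ≈⟨ collect e s (A 0) (A 1) (A 2) (A 3) ⟩
    e * A 2 + s * (e * (e * A 0) + s * (e * 1#))
      ≈⟨ +-cong refl (*-cong refl (sym (+-cong (*-cong refl (gfAfter-blocked false 0))
             (*-cong refl (trans (gfAfter-blocked true 0) (*-cong refl (gfAfter-zero true false))))))) ⟩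
    e * A 2 + s * (e * gfAfter true false 1 + s * gfAfter true true 1)
      ≈⟨ sym (trans (gfAfter-free false 2) (+-cong refl (*-cong refl (gfAfter-free true 1)))) ⟩
    A 3 ∎
    where
    collect : ∀ E S A₀ A₁ A₂ A₃ →
      E * (S * S) + (A₀ * ((E * E) * S) + (A₁ * 0# + (A₂ * E + (A₃ * 0# + 0#))))
      ≈ E * A₂ + S * (E * (E * A₀) + S * (E * 1#))
    collect = solve 6 (λ E S A₀ A₁ A₂ A₃ →
      E :* (S :* S) :+ (A₀ :* ((E :* E) :* S) :+ (A₁ :* con 0 :+ (A₂ :* E :+ (A₃ :* con 0 :+ con 0))))
      := E :* A₂ :+ S :* (E :* (E :* A₀) :+ S :* (E :* con 1))) refl
  A≈numCoeff+feedback·A (suc (suc (suc (suc m)))) = begin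
    0# + cauchy A feedback (4 ℕ.+ m)
      ≈⟨ +-cong refl (cauchy-shift 4 feedback (λ _ → refl) m A) ⟩
    0# + cauchy (λ k → A (k ℕ.+ m)) feedback 4
      ≈⟨ collect e s (A m) (A (1 ℕ.+ m)) (A (2 ℕ.+ m)) (A (3 ℕ.+ m)) (A (4 ℕ.+ m)) ⟩
    e * A (3 ℕ.+ m) + (e * e * s) * A (1 ℕ.+ m) + (e * e * (s * s)) * A m
      ≈⟨ sym (A-recurrence m) ⟩
    A (4 ℕ.+ m) ∎
    where
    collect : ∀ E S A₀ A₁ A₂ A₃ A₄ →
      0# + (A₀ * ((E * E) * (S * S)) + (A₁ * ((E * E) * S) + (A₂ * 0# + (A₃ * E + (A₄ * 0# + 0#)))))
      ≈ E * A₃ + (E * E * S) * A₁ + (E * E * (S * S)) * A₀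
    collect = solve 7 (λ E S A₀ A₁ A₂ A₃ A₄ →
      con 0 :+ (A₀ :* ((E :* E) :* (S :* S)) :+ (A₁ :* ((E :* E) :* S)
        :+ (A₂ :* con 0 :+ (A₃ :* E :+ (A₄ :* con 0 :+ con 0)))))
      := E :* A₃ :+ (E :* E :* S) :* A₁ :+ (E :* E :* (S :* S)) :* A₀) refl

  gfCoeff·denCoeff≈numCoeff : ∀ n → cauchy (gfCoeff e x y) (denCoeff e x y) n ≈ numCoeff e x y n
  gfCoeff·denCoeff≈numCoeff n = ∙-cancelʳ (cauchy A feedback n) _ _ (begin
    cauchy (gfCoeff e x y) (denCoeff e x y) n + cauchy A feedback n
      ≈⟨ +-cong (cauchy-cong {b = denCoeff e x y} gfCoeff≈A (λ _ → refl) n) refl ⟩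
    cauchy A (denCoeff e x y) n + cauchy A feedback n
      ≈⟨ cauchy-+ʳ A (denCoeff e x y) feedback n ⟩
    cauchy A (λ k → denCoeff e x y k + feedback k) n
      ≈⟨ cauchy-cong {a = A} (λ _ → refl) denCoeff+feedback≈δ n ⟩
    cauchy A δ n
      ≈⟨ cauchy-δʳ A n ⟩
    A n
      ≈⟨ sym (A≈numCoeff+feedback·A n) ⟩
    numCoeff e x y n + cauchy A feedback n ∎)

module ℤ-Totals where
  open Series +-*-commutativeRing

  pow-+1 : ∀ k → pow (+ 1) k ≡ + 1
  pow-+1 zero    = ≡.refl
  pow-+1 (suc k) rewrite pow-+1 k = ≡.refl

  sumR-weight-+1 : ∀ {n} (cs : List (Colouring n)) → sumR (map (weight (+ 1) (+ 1) (+ 1)) cs) ≡ + length cs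
  sumR-weight-+1 []       = ≡.refl
  sumR-weight-+1 (c ∷ cs)
    rewrite sumR-weight-+1 cs | pow-+1 (countColour empty c) | pow-+1 (countColour blue c)
          | pow-+1 (countColour red c) = ≡.refl

  denTotal≡denCoeff : ∀ k → denTotal k ≡ denCoeff (+ 1) (+ 1) (+ 1) k
  denTotal≡denCoeff 0 = ≡.refl
  denTotal≡denCoeff 1 = ≡.refl
  denTotal≡denCoeff 2 = ≡.refl
  denTotal≡denCoeff 3 = ≡.refl
  denTotal≡denCoeff 4 = ≡.refl
  denTotal≡denCoeff (suc (suc (suc (suc (suc _))))) = ≡.refl

  numCoeff≡numTotal : ∀ k → numCoeff (+ 1) (+ 1) (+ 1) k ≡ numTotal k
  numCoeff≡numTotal 0 = ≡.refl
  numCoeff≡numTotal 1 = ≡.refl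
  numCoeff≡numTotal 2 = ≡.refl
  numCoeff≡numTotal 3 = ≡.refl
  numCoeff≡numTotal (suc (suc (suc (suc _)))) = ≡.refl

  totals : ∀ n → cauchy (λ k → + numPositions k) denTotal n ≡ numTotal n
  totals n = ≡.trans
    (SeriesLemmas.cauchy-cong +-*-commutativeRing
      (λ k → ≡.sym (sumR-weight-+1 (cis2Positions k))) denTotal≡denCoeff n)
    (≡.trans (Cis2GF.gfCoeff·denCoeff≈numCoeff +-*-commutativeRing (+ 1) (+ 1) (+ 1) n)
             (numCoeff≡numTotal n))

mainTheorem5 : {c ℓ : Level} →
    ((R : CommutativeRing c ℓ) (e x y : CommutativeRing.Carrier R) (n : ℕ) →
      CommutativeRing._≈_ R
        (Series.cauchy R (Series.gfCoeff R e x y) (Series.denCoeff R e x y) n)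
        (Series.numCoeff R e x y n))
    × ((R : CommutativeRing c ℓ) (x y : CommutativeRing.Carrier R) (n : ℕ) →
      CommutativeRing._≈_ R
        (Series.profile R x y n)
        (Series.gfCoeff R (CommutativeRing.1# R) x y n))
    × ((n : ℕ) →
      Series.cauchy +-*-commutativeRing (λ k → + numPositions k) denTotal n ≡ numTotal n)
mainTheorem5 =
  (λ R e x y → Cis2GF.gfCoeff·denCoeff≈numCoeff R e x y) ,
  (λ R → SeriesLemmas.profile≈gfCoeff-1# R) ,
  ℤ-Totals.totals
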